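{- Let $N=\{1,\dots,n\}$ and $f:2^N\to\mathbb{R}\cup\{ -\infty\}$ with $\mathrm{dom}\, f\neq\emptyset$. Suppose $\mathcal{F}=\mathrm{dom}\, f$ satisfies (a) if $X,Y\in\mathcal{F}$ and $|X|<|Y|$, there exists $j\in Y\setminus X$ with $Y-j\in\mathcal{F}$; and (c) if $X,Y\in\mathcal{F}$, $|X|<|Y|$ and $X\setminus Y\ne\emptyset$, there exist $i\in X\setminus Y$, $j\in Y\setminus X$ with $Y+i-j\in\mathcal{F}$. If $f$ satisfies the local conditions (L1), (L2), (L3) below, then $f$ satisfies (P1): for any $X,Y\subseteq N$ with $|X|<|Y|$, $f(X)+f(Y)\le \max_{j\in Y\setminus X}\{f(X+j)+f(Y-j)\}$. (L1) for any $Z\subseteq N$ and distinct $i,j\in N\setminus Z$: $f(Z+i+j)+f(Z)\le f(Z+i)+f(Z+j)$; (L2) for any $Z\subseteq N$ and distinct $i,j,k\in N\setminus Z$: $f(Z+i+j)+f(Z+k)\le \max\{f(Z+i+k)+f(Z+j),\ f(Z+j+k)+f(Z+i)\}$; (L3) for any $Z\subseteq N$ and distinct $i,j,k,l\in N\setminus Z$: $f(Z+i+j)+f(Z+k+l)\le \max\{f(Z+i+k)+f(Z+j+l),\ f(Z+j+k)+f(Z+i+l)\}$.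
   Context: For $X\subseteq N$ and $i,j\in N$ write $X-i=X\setminus\{i\}$, $X+i=X\cup\{i\}$, $X+i-j=(X\cup\{i\})\setminus\{j\}$, etc. $\mathrm{dom}\, f=\{X\subseteq N: f(X)>-\infty\}$. Conventions: $(-\infty)+a=a+(-\infty)=(-\infty)+(-\infty)=-\infty$ for $a\in\mathbb{R}$, $-\infty\le-\infty$, and a maximum over an empty set is $-\infty$. -}

module Defs where

open import Level using (0ℓ)
open import Data.Nat using (ℕ; _<_)
open import Data.Fin using (Fin)
open import Data.Fin.Subset using (Subset; _∈_; _∉_; _∪_; ⁅_⁆; _-_; ∣_∣)
open import Data.Product using (Σ; ∃; _×_; _,_)
open import Data.Sum using (_⊎_)
open import Relation.Binary.PropositionalEquality using (_≡_; _≢_)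
open import Relation.Nullary using (¬_)

-- Agda's standard library has no real numbers; the
-- statement only uses ℝ as a totally ordered abelian group (addition and
-- comparison).  We therefore state it for an arbitrary totally ordered
-- abelian group (ℝ being one instance).

record OrderedAbelianGroup : Set₁ where
  infixl 6 _+_
  infix  4 _≤_
  field
    Carrier  : Set
    _+_      : Carrier → Carrier → Carrier
    0#       : Carrier
    -_       : Carrier → Carrier
    _≤_      : Carrier → Carrier → Set
    +-assoc  : ∀ a b c → (a + b) + c ≡ a + (b + c)
    +-comm   : ∀ a b → a + b ≡ b + a
    +-identityˡ : ∀ a → 0# + a ≡ a
    -‿inverseˡ  : ∀ a → (- a) + a ≡ 0#
    ≤-refl   : ∀ {a} → a ≤ a
    ≤-trans  : ∀ {a b c} → a ≤ b → b ≤ c → a ≤ c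
    ≤-antisym : ∀ {a b} → a ≤ b → b ≤ a → a ≡ b
    ≤-total  : ∀ a b → a ≤ b ⊎ b ≤ a
    +-monoˡ-≤ : ∀ {a b} c → a ≤ b → a + c ≤ b + c

module Extended (G : OrderedAbelianGroup) where
  open OrderedAbelianGroup G

  data Ext : Set where
    -∞  : Ext
    fin : Carrier → Ext

  infixl 6 _⊕_
  infix  4 _≼_ _≼max⟨_,_⟩

  _⊕_ : Ext → Ext → Ext
  -∞    ⊕ _     = -∞
  fin a ⊕ -∞    = -∞
  fin a ⊕ fin b = fin (a + b)

  data _≼_ : Ext → Ext → Set where
    -∞≼    : ∀ {x} → -∞ ≼ x
    fin≼   : ∀ {a b} → a ≤ b → fin a ≼ fin b

  _≼max⟨_,_⟩ : Ext → Ext → Ext → Set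
  a ≼max⟨ b , c ⟩ = a ≼ b ⊎ a ≼ c

  -- a ≤ max_{j ∈ N, P j} g j, where the maximum over an empty set is -∞:
  -- either a = -∞, or some admissible j has a ≤ g j.
  ≼maxOver : ∀ {n} → Ext → (Fin n → Set) → (Fin n → Ext) → Set
  ≼maxOver {n} a P g = (a ≡ -∞) ⊎ (Σ (Fin n) λ j → P j × a ≼ g j)

  IsFinite : Ext → Set
  IsFinite x = x ≢ -∞

  InDom : ∀ {n} → (Subset n → Ext) → Subset n → Set
  InDom f X = IsFinite (f X)

infixl 6 _+ₛ_
_+ₛ_ : ∀ {n} → Subset n → Fin n → Subset n
X +ₛ i = X ∪ ⁅ i ⁆

module Conditions (G : OrderedAbelianGroup) where
  open Extended G

  DomNonempty : ∀ {n} → (Subset n → Ext) → Set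
  DomNonempty {n} f = Σ (Subset n) λ X → InDom f X

  CondA : ∀ {n} → (Subset n → Ext) → Set
  CondA {n} f = ∀ (X Y : Subset n) → InDom f X → InDom f Y → ∣ X ∣ < ∣ Y ∣ →
    Σ (Fin n) λ j → j ∈ Y × j ∉ X × InDom f (Y - j)

  CondC : ∀ {n} → (Subset n → Ext) → Set
  CondC {n} f = ∀ (X Y : Subset n) → InDom f X → InDom f Y → ∣ X ∣ < ∣ Y ∣ →
    (Σ (Fin n) λ i → i ∈ X × i ∉ Y) →
    Σ (Fin n) λ i → Σ (Fin n) λ j →
      i ∈ X × i ∉ Y × j ∈ Y × j ∉ X × InDom f ((Y +ₛ i) - j)

  L1 : ∀ {n} → (Subset n → Ext) → Set
  L1 {n} f = ∀ (Z : Subset n) (i j : Fin n) → i ∉ Z → j ∉ Z → i ≢ j →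
    f (Z +ₛ i +ₛ j) ⊕ f Z ≼ f (Z +ₛ i) ⊕ f (Z +ₛ j)

  L2 : ∀ {n} → (Subset n → Ext) → Set
  L2 {n} f = ∀ (Z : Subset n) (i j k : Fin n) → i ∉ Z → j ∉ Z → k ∉ Z →
    i ≢ j → i ≢ k → j ≢ k →
    f (Z +ₛ i +ₛ j) ⊕ f (Z +ₛ k) ≼max⟨
      f (Z +ₛ i +ₛ k) ⊕ f (Z +ₛ j) , f (Z +ₛ j +ₛ k) ⊕ f (Z +ₛ i) ⟩

  L3 : ∀ {n} → (Subset n → Ext) → Set
  L3 {n} f = ∀ (Z : Subset n) (i j k l : Fin n) →
    i ∉ Z → j ∉ Z → k ∉ Z → l ∉ Z →
    i ≢ j → i ≢ k → i ≢ l → j ≢ k → j ≢ l → k ≢ l →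
    f (Z +ₛ i +ₛ j) ⊕ f (Z +ₛ k +ₛ l) ≼max⟨
      f (Z +ₛ i +ₛ k) ⊕ f (Z +ₛ j +ₛ l) , f (Z +ₛ j +ₛ k) ⊕ f (Z +ₛ i +ₛ l) ⟩

  P1 : ∀ {n} → (Subset n → Ext) → Set
  P1 {n} f = ∀ (X Y : Subset n) → ∣ X ∣ < ∣ Y ∣ →
    ≼maxOver (f X ⊕ f Y) (λ j → j ∈ Y × j ∉ X) (λ j → f (X +ₛ j) ⊕ f (Y - j))

{-# OPTIONS --safe #-}
-- Induction on |X ∪ Y|, where X, Y ∈ dom f (otherwise the left-hand side is -∞).
-- If X ⊆ Y, condition (a) gives j ∈ Y ∖ X with Y - j ∈ dom f: either X = Y - j and j
-- works, or induction for (X, Y - j) yields k, and (L1) at Y - j - k transfers the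
-- bound from Y - j to Y.  If a ∈ X ∖ Y, condition (c) makes some swap Y + a - b
-- feasible; take b maximising f (Y + a - b) - f (Y - b) among all feasible swaps.
-- Induction for (X, Y + a - b) yields k, and (L2) at Y - b - k with the elements
-- b, k, a, together with the maximality of b, transfers the bound back to Y.
module Submission where

open import Level using (0ℓ)
open import Defs
open import Data.Nat using (ℕ; suc; _<_)
open import Data.Nat.Induction using (<-wellFounded)
open import Data.Fin using (Fin; zero; suc; _≟_)
open import Data.Fin.Properties using (any?)
open import Data.Fin.Subset
  using (Subset; inside; outside; _∈_; _∉_; _∪_; ⁅_⁆; _-_; ∣_∣; _⊆_; _⊂_)
open import Data.Fin.Subset.Properties
  using (_∈?_; x∈⁅x⁆; x∈⁅y⁆⇒x≡y; x∈p∪q⁻; x∈p∪q⁺; q⊆p∪q; p─q⊆p; p─⊥≡p;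
         ∪-identityʳ; x∈p∧x≢y⇒x∈p-y; p─x─y≡p─y─x; ⊆-antisym; p⊂q⇒∣p∣<∣q∣)
open import Data.List using (List; allFin; filter)
open import Data.List.Relation.Unary.All using (lookup)
open import Data.List.Relation.Unary.All.Properties using (all-filter)
open import Data.List.Membership.Propositional.Properties using (∈-filter⁺; ∈-allFin)
open import Data.Vec using (_∷_; here; there)
open import Data.Product using (∃; _×_; _,_; proj₂)
open import Data.Sum using (_⊎_; inj₁; inj₂)
import Data.Sum as Sum
open import Function using (_∘_; id)
open import Induction.WellFounded using (Acc; acc)
open import Relation.Binary.Bundles using (Poset; TotalOrder)
open import Relation.Binary.PropositionalEquality
open import Relation.Nullary using (Dec; yes; no; ¬?; contradiction)
open import Relation.Nullary.Decidable using (_×-dec_)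
open import Relation.Unary using (Pred; Decidable)

private
  variable
    n : ℕ

x∉p-x : ∀ (p : Subset n) x → x ∉ p - x
x∉p-x (inside  ∷ p) zero    ()
x∉p-x (outside ∷ p) zero    ()
x∉p-x (_       ∷ p) (suc x) (there x∈p-x) = x∉p-x p x x∈p-x

p-x⊆p : ∀ {p : Subset n} {x} → p - x ⊆ p
p-x⊆p {p = p} {x} = p─q⊆p p ⁅ x ⁆

x∈p-y⇒x≢y : ∀ {p : Subset n} {x y} → x ∈ p - y → x ≢ y
x∈p-y⇒x≢y {p = p} x∈p-x refl = x∉p-x p _ x∈p-x

x∈p+y⁻ : ∀ {p : Subset n} {x y} → x ∈ p +ₛ y → x ∈ p ⊎ x ≡ y
x∈p+y⁻ {p = p} {y = y} x∈p+y with x∈p∪q⁻ p ⁅ y ⁆ x∈p+y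
... | inj₁ x∈p  = inj₁ x∈p
... | inj₂ x∈⁅y⁆ = inj₂ (x∈⁅y⁆⇒x≡y y x∈⁅y⁆)

x∈p⇒x∈p+y : ∀ {p : Subset n} {x} y → x ∈ p → x ∈ p +ₛ y
x∈p⇒x∈p+y _ x∈p = x∈p∪q⁺ (inj₁ x∈p)

x∈p+x : ∀ (p : Subset n) x → x ∈ p +ₛ x
x∈p+x _ x = x∈p∪q⁺ (inj₂ (x∈⁅x⁆ x))

p⊆q⇒p⊆q-x : ∀ {p q : Subset n} {x} → p ⊆ q → x ∉ p → p ⊆ q - x
p⊆q⇒p⊆q-x p⊆q x∉p y∈p = x∈p∧x≢y⇒x∈p-y (p⊆q y∈p) λ { refl → x∉p y∈p }

p+x-y⊆q∪p : ∀ {p q : Subset n} {x y} → x ∈ q → p +ₛ x - y ⊆ q ∪ p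
p+x-y⊆q∪p x∈q z∈ with x∈p+y⁻ (p-x⊆p z∈)
... | inj₁ z∈p  = x∈p∪q⁺ (inj₂ z∈p)
... | inj₂ refl = x∈p∪q⁺ (inj₁ x∈q)

p-x+x≡p : ∀ {p : Subset n} {x} → x ∈ p → (p - x) +ₛ x ≡ p
p-x+x≡p {p = p} {x = x} x∈p = ⊆-antisym sub sup
  where
  sub : (p - x) +ₛ x ⊆ p
  sub y∈ with x∈p+y⁻ y∈
  ... | inj₁ y∈p-x = p-x⊆p y∈p-x
  ... | inj₂ refl  = x∈p
  sup : p ⊆ (p - x) +ₛ x
  sup {y} y∈p with y ≟ x
  ... | yes refl = x∈p+x (p - x) x
  ... | no  y≢x  = x∈p⇒x∈p+y x (x∈p∧x≢y⇒x∈p-y y∈p y≢x)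

p-y+x≡p+x-y : ∀ {p : Subset n} {x y} → x ≢ y → (p - y) +ₛ x ≡ p +ₛ x - y
p-y+x≡p+x-y {p = p} {x = x} {y = y} x≢y = ⊆-antisym sub sup
  where
  sub : (p - y) +ₛ x ⊆ p +ₛ x - y
  sub z∈ with x∈p+y⁻ z∈
  ... | inj₁ z∈p-y = x∈p∧x≢y⇒x∈p-y (x∈p⇒x∈p+y x (p-x⊆p z∈p-y)) (x∈p-y⇒x≢y z∈p-y)
  ... | inj₂ refl  = x∈p∧x≢y⇒x∈p-y (x∈p+x p x) x≢y
  sup : p +ₛ x - y ⊆ (p - y) +ₛ x
  sup z∈ with x∈p+y⁻ (p-x⊆p z∈)
  ... | inj₁ z∈p = x∈p⇒x∈p+y x (x∈p∧x≢y⇒x∈p-y z∈p (x∈p-y⇒x≢y z∈))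
  ... | inj₂ refl = x∈p+x (p - y) x

p-x-y+y≡p-x : ∀ {p : Subset n} {x y} → y ∈ p → y ≢ x → (p - x - y) +ₛ y ≡ p - x
p-x-y+y≡p-x y∈p y≢x = p-x+x≡p (x∈p∧x≢y⇒x∈p-y y∈p y≢x)

p-x-y+x≡p-y : ∀ {p : Subset n} {x y} → x ∈ p → x ≢ y → (p - x - y) +ₛ x ≡ p - y
p-x-y+x≡p-y {p = p} {x} {y} x∈p x≢y =
  trans (cong (_+ₛ x) (p─x─y≡p─y─x p x y)) (p-x-y+y≡p-x x∈p x≢y)

x∈p⇒suc∣p-x∣≡∣p∣ : ∀ {p : Subset n} {x} → x ∈ p → suc ∣ p - x ∣ ≡ ∣ p ∣
x∈p⇒suc∣p-x∣≡∣p∣ {p = inside  ∷ p} here        = cong (suc ∘ ∣_∣) (p─⊥≡p p)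
x∈p⇒suc∣p-x∣≡∣p∣ {p = inside  ∷ p} (there x∈p) = cong suc (x∈p⇒suc∣p-x∣≡∣p∣ x∈p)
x∈p⇒suc∣p-x∣≡∣p∣ {p = outside ∷ p} (there x∈p) = x∈p⇒suc∣p-x∣≡∣p∣ x∈p

x∉p⇒∣p+x∣≡suc∣p∣ : ∀ {p : Subset n} {x} → x ∉ p → ∣ p +ₛ x ∣ ≡ suc ∣ p ∣
x∉p⇒∣p+x∣≡suc∣p∣ {p = inside  ∷ p} {zero}  x∉p = contradiction here x∉p
x∉p⇒∣p+x∣≡suc∣p∣ {p = outside ∷ p} {zero}  x∉p = cong (suc ∘ ∣_∣) (∪-identityʳ p)
x∉p⇒∣p+x∣≡suc∣p∣ {p = inside  ∷ p} {suc x} x∉p = cong suc (x∉p⇒∣p+x∣≡suc∣p∣ (x∉p ∘ there))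
x∉p⇒∣p+x∣≡suc∣p∣ {p = outside ∷ p} {suc x} x∉p = x∉p⇒∣p+x∣≡suc∣p∣ (x∉p ∘ there)

∣p+x-y∣≡∣p∣ : ∀ {p : Subset n} {x y} → x ∉ p → y ∈ p → ∣ p +ₛ x - y ∣ ≡ ∣ p ∣
∣p+x-y∣≡∣p∣ {p = p} {x = x} {y = y} x∉p y∈p = begin
  ∣ p +ₛ x - y ∣     ≡⟨ cong ∣_∣ (p-y+x≡p+x-y {p = p} x≢y) ⟨
  ∣ (p - y) +ₛ x ∣   ≡⟨ x∉p⇒∣p+x∣≡suc∣p∣ {p = p - y} (x∉p ∘ p-x⊆p) ⟩
  suc ∣ p - y ∣      ≡⟨ x∈p⇒suc∣p-x∣≡∣p∣ y∈p ⟩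
  ∣ p ∣              ∎
  where
  open ≡-Reasoning
  x≢y : x ≢ y
  x≢y refl = x∉p y∈p

⊆⊎∃∈∉ : ∀ (p q : Subset n) → p ⊆ q ⊎ ∃ λ x → x ∈ p × x ∉ q
⊆⊎∃∈∉ p q with any? (λ x → x ∈? p ×-dec ¬? (x ∈? q))
... | yes x∈p∖q = inj₂ x∈p∖q
... | no  p∖q≡∅ = inj₁ p⊆q
  where
  p⊆q : p ⊆ q
  p⊆q {x} x∈p with x ∈? q
  ... | yes x∈q = x∈q
  ... | no  x∉q = contradiction (x , x∈p , x∉q) p∖q≡∅

⊆⇒≡⊎⊂ : ∀ {p q : Subset n} → p ⊆ q → p ≡ q ⊎ p ⊂ q
⊆⇒≡⊎⊂ {p = p} {q = q} p⊆q with ⊆⊎∃∈∉ q p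
... | inj₁ q⊆p   = inj₁ (⊆-antisym p⊆q q⊆p)
... | inj₂ x∈q∖p = inj₂ (p⊆q , x∈q∖p)

∣p∪r∣<∣p∪q∣ : ∀ {p q r : Subset n} {x} → r ⊆ p ∪ q → x ∈ q → x ∉ p → x ∉ r →
              ∣ p ∪ r ∣ < ∣ p ∪ q ∣
∣p∪r∣<∣p∪q∣ {p = p} {q = q} {r = r} {x = x} r⊆p∪q x∈q x∉p x∉r =
  p⊂q⇒∣p∣<∣q∣ (p∪r⊆p∪q , x , x∈p∪q⁺ (inj₂ x∈q) , x∉p∪r)
  where
  p∪r⊆p∪q : p ∪ r ⊆ p ∪ q
  p∪r⊆p∪q y∈ with x∈p∪q⁻ p r y∈
  ... | inj₁ y∈p = x∈p∪q⁺ (inj₁ y∈p)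
  ... | inj₂ y∈r = r⊆p∪q y∈r
  x∉p∪r : x ∉ p ∪ r
  x∉p∪r x∈ with x∈p∪q⁻ p r x∈
  ... | inj₁ x∈p = x∉p x∈p
  ... | inj₂ x∈r = x∉r x∈r

module OrderedAbelianGroupProperties (G : OrderedAbelianGroup) where
  open OrderedAbelianGroup G

  ≤-reflexive : ∀ {a b} → a ≡ b → a ≤ b
  ≤-reflexive refl = ≤-refl

  ≤-poset : Poset 0ℓ 0ℓ 0ℓ
  ≤-poset = record
    { isPartialOrder = record
      { isPreorder = record
        { isEquivalence = isEquivalence
        ; reflexive     = ≤-reflexive
        ; trans         = ≤-trans
        }
      ; antisym = ≤-antisym
      }
    }

  -‿inverseʳ : ∀ a → a + - a ≡ 0#
  -‿inverseʳ a = trans (+-comm a (- a)) (-‿inverseˡ a)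

  +-monoʳ-≤ : ∀ c {a b} → a ≤ b → c + a ≤ c + b
  +-monoʳ-≤ c {a} {b} a≤b = subst₂ _≤_ (+-comm a c) (+-comm b c) (+-monoˡ-≤ c a≤b)

  +-mono-≤ : ∀ {a b c d} → a ≤ b → c ≤ d → a + c ≤ b + d
  +-mono-≤ {b = b} {c} a≤b c≤d = ≤-trans (+-monoˡ-≤ c a≤b) (+-monoʳ-≤ b c≤d)

  +-cancelʳ-≤ : ∀ c {a b} → a + c ≤ b + c → a ≤ b
  +-cancelʳ-≤ c {a} {b} a+c≤b+c =
    subst₂ _≤_ (x+c-c≡x a) (x+c-c≡x b) (+-monoˡ-≤ (- c) a+c≤b+c)
    where
    open ≡-Reasoning
    x+c-c≡x : ∀ x → x + c + - c ≡ x
    x+c-c≡x x = begin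
      x + c + - c      ≡⟨ +-assoc x c (- c) ⟩
      x + (c + - c)    ≡⟨ cong (x +_) (-‿inverseʳ c) ⟩
      x + 0#           ≡⟨ +-comm x 0# ⟩
      0# + x           ≡⟨ +-identityˡ x ⟩
      x                ∎

  +-interchange : ∀ a b c d → (a + b) + (c + d) ≡ (a + c) + (b + d)
  +-interchange a b c d = begin
    (a + b) + (c + d)  ≡⟨ +-assoc a b (c + d) ⟩
    a + (b + (c + d))  ≡⟨ cong (a +_) (+-assoc b c d) ⟨
    a + ((b + c) + d)  ≡⟨ cong (λ e → a + (e + d)) (+-comm b c) ⟩
    a + ((c + b) + d)  ≡⟨ cong (a +_) (+-assoc c b d) ⟩
    a + (c + (b + d))  ≡⟨ +-assoc a c (b + d) ⟨
    (a + c) + (b + d)  ∎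
    where open ≡-Reasoning

  ≤-exchange : ∀ {x h p q y r} → x + h ≤ p + q → y + q ≤ h + r → x + y ≤ p + r
  ≤-exchange {x} {h} {p} {q} {y} {r} l₁ l₂ = +-cancelʳ-≤ (h + q) (begin
    (x + y) + (h + q)  ≡⟨ +-interchange x y h q ⟩
    (x + h) + (y + q)  ≤⟨ +-mono-≤ l₁ l₂ ⟩
    (p + q) + (h + r)  ≡⟨ cong ((p + q) +_) (+-comm h r) ⟩
    (p + q) + (r + h)  ≡⟨ +-interchange p q r h ⟩
    (p + r) + (q + h)  ≡⟨ cong ((p + r) +_) (+-comm q h) ⟩
    (p + r) + (h + q)  ∎)
    where open import Relation.Binary.Reasoning.PartialOrder ≤-poset

module ExtendedProperties (G : OrderedAbelianGroup) where
  open OrderedAbelianGroup G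
  open OrderedAbelianGroupProperties G
  open Extended G

  ≼-reflexive : ∀ {x y} → x ≡ y → x ≼ y
  ≼-reflexive { -∞}    refl = -∞≼
  ≼-reflexive {fin a} refl = fin≼ ≤-refl

  ≼-trans : ∀ {x y z} → x ≼ y → y ≼ z → x ≼ z
  ≼-trans -∞≼        _          = -∞≼
  ≼-trans (fin≼ a≤b) (fin≼ b≤c) = fin≼ (≤-trans a≤b b≤c)

  ≼-antisym : ∀ {x y} → x ≼ y → y ≼ x → x ≡ y
  ≼-antisym -∞≼        -∞≼        = refl
  ≼-antisym (fin≼ a≤b) (fin≼ b≤a) = cong fin (≤-antisym a≤b b≤a)

  ≼-total : ∀ x y → x ≼ y ⊎ y ≼ x
  ≼-total -∞      _       = inj₁ -∞≼
  ≼-total (fin a) -∞      = inj₂ -∞≼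
  ≼-total (fin a) (fin b) = Sum.map fin≼ fin≼ (≤-total a b)

  ≼-totalOrder : TotalOrder 0ℓ 0ℓ 0ℓ
  ≼-totalOrder = record
    { isTotalOrder = record
      { isPartialOrder = record
        { isPreorder = record
          { isEquivalence = isEquivalence
          ; reflexive     = ≼-reflexive
          ; trans         = ≼-trans
          }
        ; antisym = ≼-antisym
        }
      ; total = ≼-total
      }
    }

  ≼max-resp : ∀ {a a′ b b′ c c′} → a ≡ a′ → b ≡ b′ → c ≡ c′ →
              a ≼max⟨ b , c ⟩ → a′ ≼max⟨ b′ , c′ ⟩
  ≼max-resp refl refl refl = id

  ⊕-comm : ∀ x y → x ⊕ y ≡ y ⊕ x
  ⊕-comm -∞      -∞      = refl
  ⊕-comm -∞      (fin b) = refl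
  ⊕-comm (fin a) -∞      = refl
  ⊕-comm (fin a) (fin b) = cong fin (+-comm a b)

  ⊕-zeroʳ : ∀ x → x ⊕ -∞ ≡ -∞
  ⊕-zeroʳ -∞      = refl
  ⊕-zeroʳ (fin a) = refl

  -∞⊎finite : ∀ x → x ≡ -∞ ⊎ IsFinite x
  -∞⊎finite -∞      = inj₁ refl
  -∞⊎finite (fin a) = inj₂ (λ ())

  isFinite? : ∀ x → Dec (IsFinite x)
  isFinite? -∞      = no (λ -∞-finite → -∞-finite refl)
  isFinite? (fin a) = yes (λ ())

  ⊕-finiteˡ : ∀ {x y} → IsFinite (x ⊕ y) → IsFinite x
  ⊕-finiteˡ { -∞}   x⊕y-finite = x⊕y-finite
  ⊕-finiteˡ {fin a} _          ()

  ⊕-finiteʳ : ∀ {x y} → IsFinite (x ⊕ y) → IsFinite y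
  ⊕-finiteʳ {x} { -∞}   x⊕y-finite = x⊕y-finite ∘ trans (⊕-zeroʳ x)
  ⊕-finiteʳ {x} {fin b} _          ()

  ⊕-finite : ∀ {x y} → IsFinite x → IsFinite y → IsFinite (x ⊕ y)
  ⊕-finite { -∞}   x-finite _        = contradiction refl x-finite
  ⊕-finite {fin a} { -∞}   _ y-finite = contradiction refl y-finite
  ⊕-finite {fin a} {fin b} _ _        ()

  ≼-finite : ∀ {x y} → IsFinite x → x ≼ y → IsFinite y
  ≼-finite x-finite -∞≼      = contradiction refl x-finite
  ≼-finite _        (fin≼ _) ()

  ≼-exchange : ∀ {x h p q y r} → IsFinite h →
               x ⊕ h ≼ p ⊕ q → y ⊕ q ≼ h ⊕ r → x ⊕ y ≼ p ⊕ r
  ≼-exchange {x = -∞} _ _ _ = -∞≼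
  ≼-exchange {x = fin _} {h = -∞} h-finite _ _ = contradiction refl h-finite
  ≼-exchange {x = fin _} {h = fin _} {y = -∞} _ _ _ = -∞≼
  ≼-exchange {x = fin _} {fin _} {fin _} {fin _} {fin _} {fin _} _ (fin≼ l₁) (fin≼ l₂) =
    fin≼ (≤-exchange l₁ l₂)

  -- x ⊖ -∞ is junk; only finite values are subtracted below.
  _⊖_ : Ext → Ext → Ext
  x ⊖ -∞    = -∞
  x ⊖ fin c = x ⊕ fin (- c)

  ⊖-≼⇒⊕-≼ : ∀ {u u′ v v′} → IsFinite u → IsFinite u′ →
            v ⊖ u ≼ v′ ⊖ u′ → u′ ⊕ v ≼ u ⊕ v′
  ⊖-≼⇒⊕-≼ { -∞}    u-finite _ _ = contradiction refl u-finite
  ⊖-≼⇒⊕-≼ {fin c} { -∞} _ u′-finite _ = contradiction refl u′-finite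
  ⊖-≼⇒⊕-≼ {fin c} {fin c′} {v} {v′} _ _ v-c≼v′-c′ =
    subst₂ _≼_ (⊕-comm v (fin c′)) (⊕-comm v′ (fin c))
      (≼-exchange (λ ()) v-c≼v′-c′
        (fin≼ (≤-reflexive (trans (-‿inverseʳ c′) (sym (-‿inverseˡ c))))))

  -- b maximises u - v on P, a value v b = -∞ counting as +∞.
  maximise-difference : ∀ {P : Pred (Fin n) 0ℓ} → Decidable P → (u v : Fin n → Ext) →
    (∀ {k} → P k → IsFinite (u k)) → ∃ P →
    ∃ λ b → P b × (∀ {k} → P k → u k ⊕ v b ≼ u b ⊕ v k)
  maximise-difference {n} {P} P? u v u-finite (b₀ , Pb₀) = b , Pb , b-maximal
    where
    open import Data.List.Extrema ≼-totalOrder using (argmin; argmin-all; f[argmin]≤f[xs])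
    key : Fin n → Ext
    key k = v k ⊖ u k
    candidates : List (Fin n)
    candidates = filter P? (allFin n)
    b : Fin n
    b = argmin key b₀ candidates
    Pb : P b
    Pb = argmin-all key Pb₀ (all-filter P? (allFin n))
    b-maximal : ∀ {k} → P k → u k ⊕ v b ≼ u b ⊕ v k
    b-maximal {k} Pk = ⊖-≼⇒⊕-≼ (u-finite Pb) (u-finite Pk)
      (lookup (f[argmin]≤f[xs] b₀ candidates) (∈-filter⁺ P? (∈-allFin k) Pk))

module Exchange (G : OrderedAbelianGroup) {n : ℕ} (f : Subset n → Extended.Ext G) where
  open Extended G
  open ExtendedProperties G
  open Conditions G

  f⊕f-cong : ∀ {A A′ B B′} → A ≡ A′ → B ≡ B′ → f A ⊕ f B ≡ f A′ ⊕ f B′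
  f⊕f-cong = cong₂ (λ A B → f A ⊕ f B)

  L1-removal : L1 f → ∀ {Y j k} → j ∈ Y → k ∈ Y → j ≢ k →
               f Y ⊕ f (Y - j - k) ≼ f (Y - j) ⊕ f (Y - k)
  L1-removal l1 {Y} {j} {k} j∈Y k∈Y j≢k =
    subst₂ _≼_ (f⊕f-cong Z+k+j≡Y refl) (f⊕f-cong Z+k≡Y-j Z+j≡Y-k)
      (l1 Z k j (x∉p-x (Y - j) k) (x∉p-x Y j ∘ p-x⊆p) (j≢k ∘ sym))
    where
    Z : Subset n
    Z = Y - j - k
    Z+k≡Y-j : Z +ₛ k ≡ Y - j
    Z+k≡Y-j = p-x-y+y≡p-x k∈Y (j≢k ∘ sym)
    Z+j≡Y-k : Z +ₛ j ≡ Y - k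
    Z+j≡Y-k = p-x-y+x≡p-y j∈Y j≢k
    Z+k+j≡Y : Z +ₛ k +ₛ j ≡ Y
    Z+k+j≡Y = trans (cong (_+ₛ j) Z+k≡Y-j) (p-x+x≡p j∈Y)

  L2-swap : L2 f → ∀ {Y a b k} → b ∈ Y → k ∈ Y → a ∉ Y → b ≢ k →
            f Y ⊕ f (Y +ₛ a - b - k)
              ≼max⟨ f (Y +ₛ a - k) ⊕ f (Y - b) , f (Y +ₛ a - b) ⊕ f (Y - k) ⟩
  L2-swap l2 {Y} {a} {b} {k} b∈Y k∈Y a∉Y b≢k =
    ≼max-resp (f⊕f-cong Z+b+k≡Y Z+a≡Y+a-b-k)
              (f⊕f-cong Z+b+a≡Y+a-k Z+k≡Y-b)
              (f⊕f-cong Z+k+a≡Y+a-b Z+b≡Y-k)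
      (l2 Z b k a (x∉p-x Y b ∘ p-x⊆p) (x∉p-x (Y - b) k) (a∉Y ∘ p-x⊆p ∘ p-x⊆p) b≢k b≢a k≢a)
    where
    Z : Subset n
    Z = Y - b - k
    b≢a : b ≢ a
    b≢a refl = a∉Y b∈Y
    k≢a : k ≢ a
    k≢a refl = a∉Y k∈Y
    Z+b≡Y-k : Z +ₛ b ≡ Y - k
    Z+b≡Y-k = p-x-y+x≡p-y b∈Y b≢k
    Z+k≡Y-b : Z +ₛ k ≡ Y - b
    Z+k≡Y-b = p-x-y+y≡p-x k∈Y (b≢k ∘ sym)
    Z+b+k≡Y : Z +ₛ b +ₛ k ≡ Y
    Z+b+k≡Y = trans (cong (_+ₛ k) Z+b≡Y-k) (p-x+x≡p k∈Y)
    Z+a≡Y+a-b-k : Z +ₛ a ≡ Y +ₛ a - b - k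
    Z+a≡Y+a-b-k =
      trans (p-y+x≡p+x-y (k≢a ∘ sym)) (cong (_- k) (p-y+x≡p+x-y (b≢a ∘ sym)))
    Z+b+a≡Y+a-k : Z +ₛ b +ₛ a ≡ Y +ₛ a - k
    Z+b+a≡Y+a-k = trans (cong (_+ₛ a) Z+b≡Y-k) (p-y+x≡p+x-y (k≢a ∘ sym))
    Z+k+a≡Y+a-b : Z +ₛ k +ₛ a ≡ Y +ₛ a - b
    Z+k+a≡Y+a-b = trans (cong (_+ₛ a) Z+k≡Y-b) (p-y+x≡p+x-y (b≢a ∘ sym))

  Exchange : Subset n → Subset n → Set
  Exchange X Y = ∃ λ j → (j ∈ Y × j ∉ X) × f X ⊕ f Y ≼ f (X +ₛ j) ⊕ f (Y - j)

  ExchangeBelow : ℕ → Set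
  ExchangeBelow m = ∀ {X Y} → ∣ X ∪ Y ∣ < m →
                    InDom f X → InDom f Y → ∣ X ∣ < ∣ Y ∣ → Exchange X Y

  exchange-⊆ : CondA f → L1 f → ∀ {X Y} → ExchangeBelow ∣ X ∪ Y ∣ →
               InDom f X → InDom f Y → ∣ X ∣ < ∣ Y ∣ → X ⊆ Y → Exchange X Y
  exchange-⊆ ca l1 {X} {Y} ih X∈dom Y∈dom ∣X∣<∣Y∣ X⊆Y with ca X Y X∈dom Y∈dom ∣X∣<∣Y∣
  ... | j , j∈Y , j∉X , Y-j∈dom with ⊆⇒≡⊎⊂ (p⊆q⇒p⊆q-x X⊆Y j∉X)
  ...   | inj₁ refl = j , (j∈Y , j∉X) , ≼-reflexive
    (trans (⊕-comm (f X) (f Y)) (cong (λ W → f W ⊕ f X) (sym (p-x+x≡p j∈Y))))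
  ...   | inj₂ X⊂Y-j
    with ih (∣p∪r∣<∣p∪q∣ (q⊆p∪q X Y ∘ p-x⊆p) j∈Y j∉X (x∉p-x Y j)) X∈dom Y-j∈dom
            (p⊂q⇒∣p∣<∣q∣ X⊂Y-j)
  ...     | k , (k∈Y-j , k∉X) , X,Y-j-bound = k , (p-x⊆p k∈Y-j , k∉X) ,
    ≼-exchange Y-j∈dom X,Y-j-bound
      (L1-removal l1 j∈Y (p-x⊆p k∈Y-j) (x∈p-y⇒x≢y k∈Y-j ∘ sym))

  SwapPartner : Subset n → Subset n → Fin n → Fin n → Set
  SwapPartner X Y a k = k ∈ Y × k ∉ X × InDom f (Y +ₛ a - k)

  swapPartner? : ∀ X Y a → Decidable (SwapPartner X Y a)
  swapPartner? X Y a k = k ∈? Y ×-dec ¬? (k ∈? X) ×-dec isFinite? (f (Y +ₛ a - k))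

  -- Y′ stands for Y +ₛ a - b.
  exchange-⊈ : CondC f → L2 f → ∀ {X Y} → ExchangeBelow ∣ X ∪ Y ∣ →
               InDom f X → InDom f Y → ∣ X ∣ < ∣ Y ∣ → (∃ λ a → a ∈ X × a ∉ Y) →
               Exchange X Y
  exchange-⊈ cc l2 {X} {Y} ih X∈dom Y∈dom ∣X∣<∣Y∣ a∈X∖Y
    with cc X Y X∈dom Y∈dom ∣X∣<∣Y∣ a∈X∖Y
  ... | a , b₀ , a∈X , a∉Y , b₀-partner
    with maximise-difference (swapPartner? X Y a) (λ k → f (Y +ₛ a - k)) (λ k → f (Y - k))
           (proj₂ ∘ proj₂) (b₀ , b₀-partner)
  ... | b , (b∈Y , b∉X , Y′∈dom) , b-maximal
    with ih (∣p∪r∣<∣p∪q∣ (p+x-y⊆q∪p a∈X) b∈Y b∉X (x∉p-x (Y +ₛ a) b)) X∈dom Y′∈dom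
            (subst (∣ X ∣ <_) (sym (∣p+x-y∣≡∣p∣ a∉Y b∈Y)) ∣X∣<∣Y∣)
  ... | k , (k∈Y′ , k∉X) , X,Y′-bound =
    k , (k∈Y , k∉X) , ≼-exchange Y′∈dom X,Y′-bound Y,Y′-k-bound
    where
    k∈Y : k ∈ Y
    k∈Y with x∈p+y⁻ (p-x⊆p k∈Y′)
    ... | inj₁ k∈Y  = k∈Y
    ... | inj₂ refl = contradiction a∈X k∉X
    Y′-k∈dom : InDom f (Y +ₛ a - b - k)
    Y′-k∈dom = ⊕-finiteʳ (≼-finite (⊕-finite X∈dom Y′∈dom) X,Y′-bound)
    Y,Y′-k-bound : f Y ⊕ f (Y +ₛ a - b - k) ≼ f (Y +ₛ a - b) ⊕ f (Y - k)
    Y,Y′-k-bound with L2-swap l2 b∈Y k∈Y a∉Y (x∈p-y⇒x≢y k∈Y′ ∘ sym)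
    ... | inj₁ via-Y+a-k = ≼-trans via-Y+a-k (b-maximal (k∈Y , k∉X , Y+a-k∈dom))
      where
      Y+a-k∈dom : InDom f (Y +ₛ a - k)
      Y+a-k∈dom = ⊕-finiteˡ (≼-finite (⊕-finite Y∈dom Y′-k∈dom) via-Y+a-k)
    ... | inj₂ via-Y′ = via-Y′

  exchange : CondA f → CondC f → L1 f → L2 f → ∀ X Y → Acc _<_ ∣ X ∪ Y ∣ →
             InDom f X → InDom f Y → ∣ X ∣ < ∣ Y ∣ → Exchange X Y
  exchange ca cc l1 l2 X Y (acc rs) X∈dom Y∈dom ∣X∣<∣Y∣ =
    Sum.[ exchange-⊆ ca l1 ih X∈dom Y∈dom ∣X∣<∣Y∣
        , exchange-⊈ cc l2 ih X∈dom Y∈dom ∣X∣<∣Y∣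
        ]′ (⊆⊎∃∈∉ X Y)
    where
    ih : ExchangeBelow ∣ X ∪ Y ∣
    ih lt = exchange ca cc l1 l2 _ _ (rs lt)

  P1-holds : CondA f → CondC f → L1 f → L2 f → P1 f
  P1-holds ca cc l1 l2 X Y ∣X∣<∣Y∣ with -∞⊎finite (f X) | -∞⊎finite (f Y)
  ... | inj₁ fX≡-∞ | _          = inj₁ (cong (_⊕ f Y) fX≡-∞)
  ... | inj₂ _     | inj₁ fY≡-∞ = inj₁ (trans (cong (f X ⊕_) fY≡-∞) (⊕-zeroʳ (f X)))
  ... | inj₂ X∈dom | inj₂ Y∈dom =
    inj₂ (exchange ca cc l1 l2 X Y (<-wellFounded ∣ X ∪ Y ∣) X∈dom Y∈dom ∣X∣<∣Y∣)

lemma3p3 : (G : OrderedAbelianGroup) → (n : ℕ) →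
    (f : Subset n → Extended.Ext G) →
    Conditions.DomNonempty G f →
    Conditions.CondA G f →
    Conditions.CondC G f →
    Conditions.L1 G f → Conditions.L2 G f → Conditions.L3 G f →
    Conditions.P1 G f
lemma3p3 G n f _ ca cc l1 l2 _ = Exchange.P1-holds G f ca cc l1 l2
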